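{- For every term $M$ of $\lambda^{Sym}_{Prop}$, $(M^{\mathfrak f})^{\mathfrak e}\to^* M$.
   Context: $\lambda^{Sym}_{Prop}$ terms are built from variables by $\langle P_1,P_2\rangle$, $\sigma_i(P)$ ($i=1,2$), $\lambda xP$, $(P_1\star P_2)$ (typed with m-types/$\bot$ as usual: $\langle P_1,P_2\rangle:A_1\wedge A_2$, $\sigma_i(P_i):A_1\vee A_2$, $\lambda xP:A^\bot$ from $x:A\vdash P:\bot$, $(P_1\star P_2):\bot$ from $P_1:A^\bot,P_2:A$). $\to^*$ is the reflexive transitive closure of the compatible closure of: $(\lambda xP\star Q)\to P[x:=Q]$; $(Q\star\lambda xP)\to P[x:=Q]$; $\lambda x(P\star x)\to P$ and $\lambda x(x\star P)\to P$ if $x\notin Fv(P)$; $(\langle P_1,P_2\rangle\star\sigma_i(Q))\to(P_i\star Q)$; $(\sigma_i(Q)\star\langle P_1,P_2\rangle)\to(Q\star P_i)$; $E[P]\to P$ for one-hole contexts $E[-]\neq[-]$ of type $\bot$ with $P:\bot$ and no free variable of $P$ bound by $E$. $\overline{\lambda}\mu\tilde{\mu}^*$ terms: $p::=\lfloor t,e\rfloor$; $t::=x\mid\lambda x\,t\mid\mu\alpha\,p\mid\overline{e}$; $e::=\alpha\mid(t.e)\mid\tilde{\mu}x\,p\mid\widetilde{t}$ ($x$ $l$-variables, which are the variables of $\lambda^{Sym}_{Prop}$; $\alpha$ $r$-variables). Translation $\cdot^{\mathfrak f}$ from $\lambda^{Sym}_{Prop}$ to $\overline{\lambda}\mu\tilde{\mu}^*$: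 $x^{\mathfrak f}=x$; $(P\star Q)^{\mathfrak f}=\lfloor Q^{\mathfrak f},\widetilde{P^{\mathfrak f}}\rfloor$; $(\lambda xN)^{\mathfrak f}=\overline{\tilde\mu x\,N^{\mathfrak f}}$; $\langle P,Q\rangle^{\mathfrak f}=\overline{(P^{\mathfrak f}.\widetilde{Q^{\mathfrak f}})}$; $\sigma_1(N)^{\mathfrak f}=\lambda x\,\mu\beta\lfloor N^{\mathfrak f},\widetilde{x}\rfloor$ ($x,\beta$ fresh); $\sigma_2(N)^{\mathfrak f}=\lambda x\,N^{\mathfrak f}$ ($x$ fresh). Translation $\cdot^{\mathfrak e}$ from $\overline{\lambda}\mu\tilde{\mu}^*$ to $\lambda^{Sym}_{Prop}$: each $r$-variable $\alpha$ has an associated fresh variable $\overline{\alpha}$; $\pi_i(y)=\lambda z(y\star\sigma_i(z))$; $\lfloor v,u\rfloor^{\mathfrak e}=(u^{\mathfrak e}\star v^{\mathfrak e})$; $x^{\mathfrak e}=x$; $(\lambda x\,u)^{\mathfrak e}=\lambda y(\lambda x(\pi_2(y)\star u^{\mathfrak e})\star\pi_1(y))$ ($y,z$ fresh); $(\mu\alpha\,p)^{\mathfrak e}=\lambda\overline{\alpha}\,p^{\mathfrak e}$; $(\overline{h})^{\mathfrak e}=h^{\mathfrak e}$; $\alpha^{\mathfrak e}=\overline{\alpha}$; $(t.h)^{\mathfrak e}=\langle t^{\mathfrak e},h^{\mathfrak e}\rangle$; $(\tilde\mu x\,p)^{\mathfrak e}=\lambda x\,p^{\mathfrak e}$; $(\widetilde{u})^{\mathfrak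 e}=u^{\mathfrak e}$. -}

module Defs where

open import Data.Nat using (ℕ; zero; suc; _+_)
open import Data.List using (List; []; _∷_)
open import Data.Unit using (⊤)
open import Data.Empty using (⊥)
open import Relation.Nullary using (¬_)
open import Relation.Binary.Construct.Closure.ReflexiveTransitive using (Star)

-- m-types of λ^Sym_Prop : atoms, negated atoms, ∧, ∨ ; the orthogonal
-- A^⊥ is the De Morgan involution.  The special type ⊥ is handled by a
-- separate syntactic sort (commands), see below.

data Ty : Set where
  atom  : ℕ → Ty
  natom : ℕ → Ty
  _∧_   : Ty → Ty → Ty
  _∨_   : Ty → Ty → Ty

_⊥ᵀ : Ty → Ty
atom X  ⊥ᵀ = natom X
natom X ⊥ᵀ = atom X
(A ∧ B) ⊥ᵀ = (A ⊥ᵀ) ∨ (B ⊥ᵀ)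
(A ∨ B) ⊥ᵀ = (A ⊥ᵀ) ∧ (B ⊥ᵀ)

-- Terms of λ^Sym_Prop (de Bruijn indices).  Tm = terms of an m-type,
-- Cm = terms of type ⊥ (which are exactly the (P ⋆ Q)).

mutual
  data Tm : Set where
    var  : ℕ → Tm
    ⟨_,_⟩ : Tm → Tm → Tm
    σ₁   : Tm → Tm
    σ₂   : Tm → Tm
    lam  : Cm → Tm

  data Cm : Set where
    _⋆_ : Tm → Tm → Cm

data _∋_∶_ : List Ty → ℕ → Ty → Set where
  here  : ∀ {Γ A} → (A ∷ Γ) ∋ zero ∶ A
  there : ∀ {Γ A B n} → Γ ∋ n ∶ A → (B ∷ Γ) ∋ suc n ∶ A

mutual
  data _⊢_∶_ (Γ : List Ty) : Tm → Ty → Set where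
    ty-var  : ∀ {n A} → Γ ∋ n ∶ A → Γ ⊢ var n ∶ A
    ty-pair : ∀ {P Q A B} → Γ ⊢ P ∶ A → Γ ⊢ Q ∶ B → Γ ⊢ ⟨ P , Q ⟩ ∶ (A ∧ B)
    ty-σ₁   : ∀ {P A B} → Γ ⊢ P ∶ A → Γ ⊢ σ₁ P ∶ (A ∨ B)
    ty-σ₂   : ∀ {P A B} → Γ ⊢ P ∶ B → Γ ⊢ σ₂ P ∶ (A ∨ B)
    ty-lam  : ∀ {P A} → (A ∷ Γ) ⊢⊥ P → Γ ⊢ lam P ∶ (A ⊥ᵀ)

  data _⊢⊥_ (Γ : List Ty) : Cm → Set where
    ty-star : ∀ {P Q A} → Γ ⊢ P ∶ (A ⊥ᵀ) → Γ ⊢ Q ∶ A → Γ ⊢⊥ (P ⋆ Q)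

ext : (ℕ → ℕ) → ℕ → ℕ
ext ρ zero    = zero
ext ρ (suc n) = suc (ρ n)

mutual
  renT : (ℕ → ℕ) → Tm → Tm
  renT ρ (var n)     = var (ρ n)
  renT ρ ⟨ P , Q ⟩   = ⟨ renT ρ P , renT ρ Q ⟩
  renT ρ (σ₁ P)      = σ₁ (renT ρ P)
  renT ρ (σ₂ P)      = σ₂ (renT ρ P)
  renT ρ (lam P)     = lam (renC (ext ρ) P)

  renC : (ℕ → ℕ) → Cm → Cm
  renC ρ (P ⋆ Q) = renT ρ P ⋆ renT ρ Q

exts : (ℕ → Tm) → ℕ → Tm
exts s zero    = var zero
exts s (suc n) = renT suc (s n)

mutual
  subT : (ℕ → Tm) → Tm → Tm
  subT s (var n)     = s n
  subT s ⟨ P , Q ⟩   = ⟨ subT s P , subT s Q ⟩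
  subT s (σ₁ P)      = σ₁ (subT s P)
  subT s (σ₂ P)      = σ₂ (subT s P)
  subT s (lam P)     = lam (subC (exts s) P)

  subC : (ℕ → Tm) → Cm → Cm
  subC s (P ⋆ Q) = subT s P ⋆ subT s Q

sub0 : Tm → ℕ → Tm
sub0 Q zero    = Q
sub0 Q (suc n) = var n

_[0:=_] : Cm → Tm → Cm
P [0:= Q ] = subC (sub0 Q) P

wkC : ℕ → Cm → Cm
wkC k = renC (k +_)

wkT : ℕ → Tm → Tm
wkT k = renT (k +_)

-- one-hole contexts with a hole of type ⊥, crossing k binders:
-- CC k : context of type ⊥ ;  CT k : context of an m-type
mutual
  data CC : ℕ → Set where
    hole : CC zero
    _⋆ˡ_ : ∀ {k} → CT k → Tm → CC k
    _⋆ʳ_ : ∀ {k} → Tm → CT k → CC k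

  data CT : ℕ → Set where
    pairˡ : ∀ {k} → CT k → Tm → CT k
    pairʳ : ∀ {k} → Tm → CT k → CT k
    σ₁ᶜ   : ∀ {k} → CT k → CT k
    σ₂ᶜ   : ∀ {k} → CT k → CT k
    lamᶜ  : ∀ {k} → CC k → CT (suc k)

mutual
  plugC : ∀ {k} → CC k → Cm → Cm
  plugC hole      P = P
  plugC (E ⋆ˡ Q)  P = plugT E P ⋆ Q
  plugC (Q ⋆ʳ E)  P = Q ⋆ plugT E P

  plugT : ∀ {k} → CT k → Cm → Tm
  plugT (pairˡ E Q) P = ⟨ plugT E P , Q ⟩
  plugT (pairʳ Q E) P = ⟨ Q , plugT E P ⟩
  plugT (σ₁ᶜ E)     P = σ₁ (plugT E P)
  plugT (σ₂ᶜ E)     P = σ₂ (plugT E P)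
  plugT (lamᶜ E)    P = lam (plugC E P)

IsHole : ∀ {k} → CC k → Set
IsHole hole     = ⊤
IsHole (_ ⋆ˡ _) = ⊥
IsHole (_ ⋆ʳ _) = ⊥

mutual
  data _⟶T_ : Tm → Tm → Set where
    η-r    : ∀ P → lam (wkT 1 P ⋆ var zero) ⟶T P
    η-l    : ∀ P → lam (var zero ⋆ wkT 1 P) ⟶T P
    c-pairˡ : ∀ {P P′ Q} → P ⟶T P′ → ⟨ P , Q ⟩ ⟶T ⟨ P′ , Q ⟩
    c-pairʳ : ∀ {P Q Q′} → Q ⟶T Q′ → ⟨ P , Q ⟩ ⟶T ⟨ P , Q′ ⟩
    c-σ₁    : ∀ {P P′} → P ⟶T P′ → σ₁ P ⟶T σ₁ P′
    c-σ₂    : ∀ {P P′} → P ⟶T P′ → σ₂ P ⟶T σ₂ P′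
    c-lam   : ∀ {P P′} → P ⟶C P′ → lam P ⟶T lam P′

  data _⟶C_ : Cm → Cm → Set where
    β-l    : ∀ P Q → (lam P ⋆ Q) ⟶C (P [0:= Q ])
    β-r    : ∀ P Q → (Q ⋆ lam P) ⟶C (P [0:= Q ])
    π₁-l   : ∀ P₁ P₂ Q → (⟨ P₁ , P₂ ⟩ ⋆ σ₁ Q) ⟶C (P₁ ⋆ Q)
    π₂-l   : ∀ P₁ P₂ Q → (⟨ P₁ , P₂ ⟩ ⋆ σ₂ Q) ⟶C (P₂ ⋆ Q)
    π₁-r   : ∀ P₁ P₂ Q → (σ₁ Q ⋆ ⟨ P₁ , P₂ ⟩) ⟶C (Q ⋆ P₁)
    π₂-r   : ∀ P₁ P₂ Q → (σ₂ Q ⋆ ⟨ P₁ , P₂ ⟩) ⟶C (Q ⋆ P₂)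
    E-rule : ∀ {k} (E : CC k) (P : Cm) → ¬ IsHole E → plugC E (wkC k P) ⟶C P
    c-⋆ˡ   : ∀ {P P′ Q} → P ⟶T P′ → (P ⋆ Q) ⟶C (P′ ⋆ Q)
    c-⋆ʳ   : ∀ {P Q Q′} → Q ⟶T Q′ → (P ⋆ Q) ⟶C (P ⋆ Q′)

_⟶T*_ : Tm → Tm → Set
_⟶T*_ = Star _⟶T_

_⟶C*_ : Cm → Cm → Set
_⟶C*_ = Star _⟶C_

-- λ̄μμ̃* (de Bruijn; one shared index space for l- and r-variables:
-- every binder λx, μα, μ̃x introduces index 0)

mutual
  data LCmd : Set where
    ⌊_,_⌋ : LTm → LCx → LCmd

  data LTm : Set where
    lvar : ℕ → LTm
    lλ   : LTm → LTm
    lμ   : LCmd → LTm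
    bar  : LCx → LTm

  data LCx : Set where
    rvar : ℕ → LCx
    _·_  : LTm → LCx → LCx
    lμ̃   : LCmd → LCx
    tl   : LTm → LCx

mutual
  renLC : (ℕ → ℕ) → LCmd → LCmd
  renLC ρ ⌊ t , e ⌋ = ⌊ renLT ρ t , renLE ρ e ⌋

  renLT : (ℕ → ℕ) → LTm → LTm
  renLT ρ (lvar x) = lvar (ρ x)
  renLT ρ (lλ t)   = lλ (renLT (ext ρ) t)
  renLT ρ (lμ p)   = lμ (renLC (ext ρ) p)
  renLT ρ (bar e)  = bar (renLE ρ e)

  renLE : (ℕ → ℕ) → LCx → LCx
  renLE ρ (rvar a) = rvar (ρ a)
  renLE ρ (t · e)  = renLT ρ t · renLE ρ e
  renLE ρ (lμ̃ p)   = lμ̃ (renLC (ext ρ) p)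
  renLE ρ (tl t)   = tl (renLT ρ t)

mutual
  fT : Tm → LTm
  fT (var x)     = lvar x
  fT (lam N)     = bar (lμ̃ (fC N))
  fT ⟨ P , Q ⟩   = bar (fT P · tl (fT Q))
  -- σ₁(N)^f = λx μβ ⌊N^f , x̃⌋   (x = index 1, β = index 0)
  fT (σ₁ N)      = lλ (lμ ⌊ renLT (2 +_) (fT N) , tl (lvar 1) ⌋)
  fT (σ₂ N)      = lλ (renLT suc (fT N))

  fC : Cm → LCmd
  fC (P ⋆ Q) = ⌊ fT Q , tl (fT P) ⌋

-- translation ·^e   (α ↦ ᾱ is the identity on indices)

-- π_i(y) = λz (y ⋆ σ_i(z)),  y given as an index outside the λz
π₁ π₂ : ℕ → Tm
π₁ y = lam (var (suc y) ⋆ σ₁ (var zero))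
π₂ y = lam (var (suc y) ⋆ σ₂ (var zero))

mutual
  eC : LCmd → Cm
  eC ⌊ v , u ⌋ = eE u ⋆ eT v

  eT : LTm → Tm
  eT (lvar x) = var x
  -- (λx u)^e = λy (λx (π₂(y) ⋆ u^e) ⋆ π₁(y))
  eT (lλ u)   = lam (lam (π₂ 1 ⋆ renT (ext suc) (eT u)) ⋆ π₁ zero)
  eT (lμ p)   = lam (eC p)
  eT (bar h)  = eE h

  eE : LCx → Tm
  eE (rvar a) = var a
  eE (t · h)  = ⟨ eT t , eE h ⟩
  eE (lμ̃ p)   = lam (eC p)
  eE (tl u)   = eT u

module Submission where

-- Both translations are compositional, so the proof is an induction on M
-- in which variables, pairs, λ and ⋆ are immediate from the induction
-- hypotheses and congruence.  The only real work is in the two injections: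
-- σ₂(N)^f = λx N^f and σ₁(N)^f = λx μβ ⌊N^f, x̃⌋ are decoded by ·^e into
-- λy (λx (π₂(y) ⋆ u) ⋆ π₁(y)), which must be reduced back to σᵢ(N^f)^e
-- using the E-rule, β and η.

open import Defs
open import Data.Nat using (ℕ; zero; suc; _+_)
open import Data.List using (List)
open import Data.Product using (_×_; _,_)
open import Function using (_∘_)
open import Relation.Binary.PropositionalEquality
  using (_≡_; refl; sym; trans; cong; cong₂; module ≡-Reasoning)
open import Relation.Nullary using (¬_)
open import Relation.Binary.Construct.Closure.ReflexiveTransitive
  using (ε; _◅◅_; gmap)
open import Relation.Binary.Construct.Closure.ReflexiveTransitive.Properties
  using (module StarReasoning)

ext-fuse : {f g h : ℕ → ℕ} → (∀ n → f (g n) ≡ h n) → ∀ n → ext f (ext g n) ≡ ext h n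
ext-fuse fg≡h zero    = refl
ext-fuse fg≡h (suc n) = cong suc (fg≡h n)

mutual
  renT-fuse : {f g h : ℕ → ℕ} → (∀ n → f (g n) ≡ h n) → ∀ X → renT f (renT g X) ≡ renT h X
  renT-fuse fg≡h (var n)   = cong var (fg≡h n)
  renT-fuse fg≡h ⟨ P , Q ⟩ = cong₂ ⟨_,_⟩ (renT-fuse fg≡h P) (renT-fuse fg≡h Q)
  renT-fuse fg≡h (σ₁ P)    = cong σ₁ (renT-fuse fg≡h P)
  renT-fuse fg≡h (σ₂ P)    = cong σ₂ (renT-fuse fg≡h P)
  renT-fuse fg≡h (lam P)   = cong lam (renC-fuse (ext-fuse fg≡h) P)

  renC-fuse : {f g h : ℕ → ℕ} → (∀ n → f (g n) ≡ h n) → ∀ X → renC f (renC g X) ≡ renC h X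
  renC-fuse fg≡h (P ⋆ Q) = cong₂ _⋆_ (renT-fuse fg≡h P) (renT-fuse fg≡h Q)

renT-square : (f g f′ g′ : ℕ → ℕ) → (∀ n → f (g n) ≡ f′ (g′ n)) →
              ∀ X → renT f (renT g X) ≡ renT f′ (renT g′ X)
renT-square f g f′ g′ square X =
  trans (renT-fuse {f} {g} {f ∘ g} (λ _ → refl) X)
        (sym (renT-fuse {f′} {g′} {f ∘ g} (λ n → sym (square n)) X))

ext-ext-suc : (ρ : ℕ → ℕ) → ∀ n → ext suc (ext ρ n) ≡ ext (ext ρ) (ext suc n)
ext-ext-suc ρ zero    = refl
ext-ext-suc ρ (suc n) = refl

-- The translation ·^e commutes with renaming of free variables; this is how
-- the weakenings built into σ₁(N)^f and σ₂(N)^f reach the λ^Sym_Prop side.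
mutual
  eT-ren : ∀ ρ t → eT (renLT ρ t) ≡ renT ρ (eT t)
  eT-ren ρ (lvar x) = refl
  eT-ren ρ (lλ u)   = cong (λ U → lam (lam (π₂ 1 ⋆ U) ⋆ π₁ zero)) (begin
    renT (ext suc) (eT (renLT (ext ρ) u))      ≡⟨ cong (renT (ext suc)) (eT-ren (ext ρ) u) ⟩
    renT (ext suc) (renT (ext ρ) (eT u))       ≡⟨ renT-square (ext suc) (ext ρ) (ext (ext ρ)) (ext suc)
                                                    (ext-ext-suc ρ) (eT u) ⟩
    renT (ext (ext ρ)) (renT (ext suc) (eT u)) ∎)
    where open ≡-Reasoning
  eT-ren ρ (lμ p)   = cong lam (eC-ren (ext ρ) p)
  eT-ren ρ (bar e)  = eE-ren ρ e

  eE-ren : ∀ ρ e → eE (renLE ρ e) ≡ renT ρ (eE e)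
  eE-ren ρ (rvar a) = refl
  eE-ren ρ (t · e)  = cong₂ ⟨_,_⟩ (eT-ren ρ t) (eE-ren ρ e)
  eE-ren ρ (lμ̃ p)   = cong lam (eC-ren (ext ρ) p)
  eE-ren ρ (tl t)   = eT-ren ρ t

  eC-ren : ∀ ρ p → eC (renLC ρ p) ≡ renC ρ (eC p)
  eC-ren ρ ⌊ t , e ⌋ = cong₂ _⋆_ (eE-ren ρ e) (eT-ren ρ t)

lam-cong* : ∀ {P P′} → P ⟶C* P′ → lam P ⟶T* lam P′
lam-cong* = gmap lam c-lam

σ₁-cong* : ∀ {P P′} → P ⟶T* P′ → σ₁ P ⟶T* σ₁ P′
σ₁-cong* = gmap σ₁ c-σ₁

σ₂-cong* : ∀ {P P′} → P ⟶T* P′ → σ₂ P ⟶T* σ₂ P′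
σ₂-cong* = gmap σ₂ c-σ₂

pair-cong* : ∀ {P P′ Q Q′} → P ⟶T* P′ → Q ⟶T* Q′ → ⟨ P , Q ⟩ ⟶T* ⟨ P′ , Q′ ⟩
pair-cong* {P′ = P′} {Q = Q} P⟶ Q⟶ = gmap (⟨_, Q ⟩) c-pairˡ P⟶ ◅◅ gmap (⟨ P′ ,_⟩) c-pairʳ Q⟶

⋆-cong* : ∀ {P P′ Q Q′} → P ⟶T* P′ → Q ⟶T* Q′ → (P ⋆ Q) ⟶C* (P′ ⋆ Q′)
⋆-cong* {P′ = P′} {Q = Q} P⟶ Q⟶ = gmap (_⋆ Q) c-⋆ˡ P⟶ ◅◅ gmap (P′ ⋆_) c-⋆ʳ Q⟶

E-rule-at : ∀ {k} (E : CC k) (P : Cm) {L : Cm} →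
            plugC E (wkC k P) ≡ L → ¬ IsHole E → L ⟶C P
E-rule-at E P refl E≢hole = E-rule E P E≢hole

-- Decoding of σ₂(N)^f = λx N^f: the image λy (λx (π₂(y) ⋆ X) ⋆ π₁(y)), with x
-- not free in X, erases λx(…) ⋆ π₁(y), then reduces by β and η to σ₂(X).
σ₂-decode : ∀ t → eT (lλ (renLT suc t)) ⟶T* σ₂ (eT t)
σ₂-decode t = begin
  lam (lam (π₂ 1 ⋆ renT (ext suc) (eT (renLT suc t))) ⋆ π₁ zero)
    ≡⟨ cong (λ U → lam (lam (π₂ 1 ⋆ U) ⋆ π₁ zero)) X-weakened ⟩
  lam (lam (π₂ 1 ⋆ renT suc (renT suc X)) ⋆ π₁ zero)
    ⟶⟨ c-lam (E-rule-at (lamᶜ hole ⋆ˡ π₁ zero) (π₂ zero ⋆ renT suc X) refl (λ ())) ⟩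
  lam (π₂ zero ⋆ renT suc X)
    ⟶⟨ c-lam (β-l _ _) ⟩
  lam (var zero ⋆ σ₂ (renT suc X))
    ⟶⟨ η-l (σ₂ X) ⟩
  σ₂ X ∎
  where
  open StarReasoning _⟶T_
  X = eT t
  X-weakened : renT (ext suc) (eT (renLT suc t)) ≡ renT suc (renT suc X)
  X-weakened = trans (cong (renT (ext suc)) (eT-ren suc t))
                     (renT-square (ext suc) suc suc suc (λ _ → refl) X)

-- Decoding of σ₁(N)^f = λx μβ ⌊N^f, x̃⌋: inside λx, the unused binder β is
-- erased together with π₂(y) by the E-rule, λx (x ⋆ X) η-contracts to X, and
-- the remaining λy (X ⋆ π₁(y)) reduces by β and η to σ₁(X).
σ₁-decode : ∀ t → eT (lλ (lμ ⌊ renLT (2 +_) t , tl (lvar 1) ⌋)) ⟶T* σ₁ (eT t)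
σ₁-decode t = begin
  lam (lam (π₂ 1 ⋆ lam (var 1 ⋆ renT (ext (ext suc)) (eT (renLT (2 +_) t)))) ⋆ π₁ zero)
    ≡⟨ cong (λ U → lam (lam (π₂ 1 ⋆ lam (var 1 ⋆ U)) ⋆ π₁ zero)) X-weakened ⟩
  lam (lam (π₂ 1 ⋆ lam (var 1 ⋆ renT suc (renT (2 +_) X))) ⋆ π₁ zero)
    ⟶⟨ c-lam (c-⋆ˡ (c-lam (E-rule-at (π₂ 1 ⋆ʳ lamᶜ hole) (var zero ⋆ renT (2 +_) X) refl (λ ())))) ⟩
  lam (lam (var zero ⋆ renT (2 +_) X) ⋆ π₁ zero)
    ≡⟨ cong (λ U → lam (lam (var zero ⋆ U) ⋆ π₁ zero)) (sym (renT-fuse (λ _ → refl) X)) ⟩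
  lam (lam (var zero ⋆ renT suc (renT suc X)) ⋆ π₁ zero)
    ⟶⟨ c-lam (c-⋆ˡ (η-l (renT suc X))) ⟩
  lam (renT suc X ⋆ π₁ zero)
    ⟶⟨ c-lam (β-r _ _) ⟩
  lam (var zero ⋆ σ₁ (renT suc X))
    ⟶⟨ η-l (σ₁ X) ⟩
  σ₁ X ∎
  where
  open StarReasoning _⟶T_
  X = eT t
  X-weakened : renT (ext (ext suc)) (eT (renLT (2 +_) t)) ≡ renT suc (renT (2 +_) X)
  X-weakened = trans (cong (renT (ext (ext suc))) (eT-ren (2 +_) t))
                     (renT-square (ext (ext suc)) (2 +_) suc (2 +_) (λ _ → refl) X)

mutual
  ef-retractT : ∀ M → eT (fT M) ⟶T* M
  ef-retractT (var x)   = ε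
  ef-retractT ⟨ P , Q ⟩ = pair-cong* (ef-retractT P) (ef-retractT Q)
  ef-retractT (σ₁ N)    = σ₁-decode (fT N) ◅◅ σ₁-cong* (ef-retractT N)
  ef-retractT (σ₂ N)    = σ₂-decode (fT N) ◅◅ σ₂-cong* (ef-retractT N)
  ef-retractT (lam N)   = lam-cong* (ef-retractC N)

  ef-retractC : ∀ M → eC (fC M) ⟶C* M
  ef-retractC (P ⋆ Q) = ⋆-cong* (ef-retractT P) (ef-retractT Q)

theorem4p14 :
    ((Γ : List Ty) (A : Ty) (M : Tm) → Γ ⊢ M ∶ A → eT (fT M) ⟶T* M)
    × ((Γ : List Ty) (M : Cm) → Γ ⊢⊥ M → eC (fC M) ⟶C* M)
theorem4p14 = (λ _ _ M _ → ef-retractT M) , (λ _ M _ → ef-retractC M)
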